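{- $\mathrm{CFL}\subsetneq Q^{\mathrm{un}}_{\mathrm{Grp}}\mathrm{FO}_{\mathrm{bit}}$.
   Context: CFL denotes the class of $\epsilon$-free context-free languages. Words over a finite ordered alphabet are viewed as finite structures with universe $\{1,\dots,n\}$, unary letter predicates $P_a$, linear order $<$, equality, constants min, max; $\mathrm{FO}_{\mathrm{bit}}$ is first-order logic over this signature extended with the predicate $\mathrm{BIT}(x,y)$, true iff the $x$th bit of the binary representation of $y$ is 1. Unary Lindström quantifier: for a language $L$ over ordered alphabet $(b_1,\dots,b_t)$ and formulas $\phi_1(x),\dots,\phi_{t-1}(x)$, $Q_L x[\phi_1,\dots,\phi_{t-1}]$ holds on $w$ of length $n$ iff the word of length $n$ whose $i$th letter is $b_j$ for the least $j$ with $w\models\phi_j(i)$, and $b_t$ if none, belongs to $L$. A groupoid is a finite set $G$ with an arbitrary binary operation; $\mathcal W(S,G)$, $S\subseteq G$, is the set of nonempty words over alphabet $G$ evaluating into $S$ under some legal bracketing. $Q^{\mathrm{un}}_{\mathrm{Grp}}\mathrm{FO}_{\mathrm{bit}}$ is the class of languages definable by applying a single unary quantifier $Q_L$, $L=\mathcal W(S,G)$ for some finite groupoid $G$, $S\subseteq G$, to a tuple of $\mathrm{FO}_{\mathrm{bit}}$ formulas. -}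

module Defs where

open import Data.Nat.Base using (ℕ; zero; suc; _+_; ⌊_/2⌋; _%_; _≡ᵇ_; _<ᵇ_)
open import Data.Fin.Base using (Fin; zero; suc; toℕ; fromℕ)
open import Data.Bool.Base using (Bool; true; false; if_then_else_; not; _∧_; _∨_; T)
open import Data.List.Base using (List; []; _∷_; _++_; allFin; tabulate; length; lookup)
open import Data.Bool.ListAction using (any; all)
open import Data.List.NonEmpty.Base using (List⁺; toList)
open import Data.List.Membership.Propositional using (_∈_)
open import Data.Sum.Base using (_⊎_; inj₁; inj₂)
open import Data.Product.Base using (Σ; _×_; _,_; ∃)
open import Relation.Nullary using (¬_)
open import Function.Bundles using (_⇔_)

-- Words and languages over the finite ordered alphabet Fin k
-- (letter order = order of Fin k).

Word : ℕ → Set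
Word k = List (Fin k)

Language : ℕ → Set₁
Language k = Word k → Set

Symbol : ℕ → ℕ → Set
Symbol m k = Fin m ⊎ Fin k     -- inj₁ = nonterminal, inj₂ = terminal

record CFG (k : ℕ) : Set where
  field
    #N    : ℕ
    start : Fin #N
    rules : List (Fin #N × List⁺ (Symbol #N k))
open CFG public

mutual
  data Derives {k : ℕ} (G : CFG k) : Fin (#N G) → Word k → Set where
    rule : ∀ {A rhs w} → (A , rhs) ∈ rules G → DerivesSeq G (toList rhs) w
         → Derives G A w

  data DerivesSeq {k : ℕ} (G : CFG k) : List (Symbol (#N G) k) → Word k → Set where
    []   : DerivesSeq G [] []
    term : ∀ {a ss w} → DerivesSeq G ss w → DerivesSeq G (inj₂ a ∷ ss) (a ∷ w)
    nont : ∀ {A ss u v} → Derives G A u → DerivesSeq G ss v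
         → DerivesSeq G (inj₁ A ∷ ss) (u ++ v)

LangOf : ∀ {k} → CFG k → Language k
LangOf G w = Derives G (start G) w

IsCFL : ∀ {k} → Language k → Set
IsCFL {k} L = Σ (CFG k) λ G → ∀ w → L w ⇔ LangOf G w

Op : ℕ → Set
Op g = Fin g → Fin g → Fin g

-- Evaluates op w x : under some legal bracketing, the nonempty word w
-- evaluates to x.
data Evaluates {g : ℕ} (op : Op g) : List (Fin g) → Fin g → Set where
  leaf : ∀ a → Evaluates op (a ∷ []) a
  node : ∀ {u v x y} → Evaluates op u x → Evaluates op v y
       → Evaluates op (u ++ v) (op x y)

WordProblem : ∀ {g} → Op g → (Fin g → Bool) → Language g
WordProblem op S w = ∃ λ x → T (S x) × Evaluates op w x

data Term (v : ℕ) : Set where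
  var : Fin v → Term v
  min max : Term v

data Formula (k : ℕ) (v : ℕ) : Set where
  letter : Fin k → Term v → Formula k v
  _≺_    : Term v → Term v → Formula k v
  _≐_    : Term v → Term v → Formula k v
  bit    : Term v → Term v → Formula k v
  neg    : Formula k v → Formula k v
  _and_ _or_ : Formula k v → Formula k v → Formula k v
  ex fa  : Formula k (suc v) → Formula k v        -- ∃x / ∀x (binds var zero)

-- the i-th bit (i = 1 is the least significant) of y, given i-1 and y
bitAt : ℕ → ℕ → Bool
bitAt zero    y = (y % 2) ≡ᵇ 1
bitAt (suc i) y = bitAt i ⌊ y /2⌋

-- number in {1,...,n+1} denoted by a position p : Fin (suc n)
pos : ∀ {n} → Fin (suc n) → ℕ
pos p = suc (toℕ p)

BIT : ∀ {n} → Fin (suc n) → Fin (suc n) → Bool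
BIT x y = bitAt (toℕ x) (pos y)

extend : ∀ {v} {A : Set} → A → (Fin v → A) → Fin (suc v) → A
extend a ρ zero    = a
extend a ρ (suc i) = ρ i

-- A nonempty word of length n+1 is a map Fin (suc n) → Fin k;
-- position p : Fin (suc n) stands for the element p+1 of {1,...,n+1}.
⟦_⟧t : ∀ {n v} → Term v → (Fin v → Fin (suc n)) → Fin (suc n)
⟦ var i ⟧t ρ = ρ i
⟦_⟧t {n} min ρ = zero
⟦_⟧t {n} max ρ = fromℕ n

eval : ∀ {k v} (n : ℕ) → (Fin (suc n) → Fin k) → (Fin v → Fin (suc n))
     → Formula k v → Bool
eval n w ρ (letter a t) = toℕ (w (⟦ t ⟧t ρ)) ≡ᵇ toℕ a
eval n w ρ (s ≺ t)      = toℕ (⟦ s ⟧t ρ) <ᵇ toℕ (⟦ t ⟧t ρ)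
eval n w ρ (s ≐ t)      = toℕ (⟦ s ⟧t ρ) ≡ᵇ toℕ (⟦ t ⟧t ρ)
eval n w ρ (bit s t)    = BIT (⟦ s ⟧t ρ) (⟦ t ⟧t ρ)
eval n w ρ (neg φ)      = not (eval n w ρ φ)
eval n w ρ (φ and ψ)    = eval n w ρ φ ∧ eval n w ρ ψ
eval n w ρ (φ or ψ)     = eval n w ρ φ ∨ eval n w ρ ψ
eval n w ρ (ex φ)       = any (λ p → eval n w (extend p ρ) φ) (allFin (suc n))
eval n w ρ (fa φ)       = all (λ p → eval n w (extend p ρ) φ) (allFin (suc n))

-- Unary Lindström quantifier Q_L x [φ_1,...,φ_t] for L over the ordered
-- alphabet Fin (suc t) = (b_1,...,b_{t+1}).

-- index of the least j with f j = true, and the last letter b_{t+1} if none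
leastTrue : ∀ {t} → (Fin t → Bool) → Fin (suc t)
leastTrue {zero}  f = zero
leastTrue {suc t} f = if f zero then zero else suc (leastTrue (λ j → f (suc j)))

inducedWord : ∀ {k t} (n : ℕ) → (Fin (suc n) → Fin k) → (Fin t → Formula k 1)
            → List (Fin (suc t))
inducedWord n w φ =
  tabulate (λ i → leastTrue (λ j → eval n w (λ _ → i) (φ j)))

-- L ∈ Q^un_Grp FO_bit : L is defined by Q_{W(S,G)} x [φ_1,...,φ_t] for some
-- finite groupoid G = (Fin (suc t), op), S ⊆ G and FO_bit formulas φ_j(x).
-- (Structures are nonempty, so such languages never contain ε.)
IsQGrpFObit : ∀ {k} → Language k → Set
IsQGrpFObit {k} L =
  Σ ℕ λ t → Σ (Op (suc t)) λ op → Σ (Fin (suc t) → Bool) λ S →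
  Σ (Fin t → Formula k 1) λ φ →
    (¬ L [])
    × (∀ x xs → L (x ∷ xs) ⇔
         WordProblem op S (inducedWord (length xs) (lookup (x ∷ xs)) φ))

module Submission where

-- For an ε-free grammar take as groupoid elements the sets of
-- forms, namely the one-symbol strings and the suffixes of right-hand sides.
-- The product of X and Y contains s ∷ ss whenever [ s ] ∈ X and ss ∈ Y, and
-- is then closed under the rules: [ A ] is added as soon as a right-hand side
-- of A is present.  A bracketing of the letter images of w can evaluate to a
-- set containing [ S ] exactly when S derives w, because every form in the
-- value of a bracketing derives the bracketed factor, and conversely a
-- derivation tree, read along its right-hand sides, is such a bracketing.
-- The letter images are expressed by unary formulas, one per element.
--
-- That the length is a power of two says that max has a single
-- 1-bit, an FO[BIT] sentence; with the groupoid x · y = x, whose word problem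
-- only looks at the first letter, any such sentence is a groupoid quantifier.
-- A unary context-free language containing a long enough word contains all
-- lengths a + i e (i ∈ ℕ) for some e ≥ 1, but no three powers of two are in
-- arithmetic progression.

open import Defs
open import Data.Bool.Base using (Bool; true; false; not; _∨_; T)
open import Data.Bool.Properties using (T-∧; T-∨; ∨-inverseˡ)
open import Data.Empty using (⊥; ⊥-elim)
open import Data.Fin.Base using (Fin; zero; suc; toℕ; fromℕ; fromℕ<; inject₁; funToFin; finToFun)
open import Data.Fin.Properties
  using (_≟_; toℕ-fromℕ; toℕ-fromℕ<; toℕ<n; toℕ-injective; suc-injective; finToFun-funToFin; any?)
open import Data.Fin.Subset using (Subset; _⊆_; _∪_; ∣_∣) renaming (_∈_ to _∈ˢ_; _∉_ to _∉ˢ_; ⊥ to ∅)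
open import Data.Fin.Subset.Properties
  using (∣p∣≤n; p⊂q⇒∣p∣<∣q∣; p⊆p∪q; x∈p∪q⁺; x∈p∪q⁻) renaming (_∈?_ to _∈ˢ?_)
open import Data.List.Base
  using (List; []; _∷_; _++_; [_]; map; length; lookup; tabulate; replicate; allFin; filter; tails; concatMap)
open import Data.List.Properties
  using ( ∷-injectiveʳ; ∷-injectiveˡ; ≡-dec; ++-identityʳ; map-++; length-++; filter-notAll
        ; length-tabulate; tabulate-cong; map-tabulate; tabulate-lookup; length-replicate )
open import Data.List.Membership.Propositional using (_∈_; find; lose)
open import Data.List.Membership.Propositional.Properties
  using (∈-allFin; ∈-map⁺; ∈-map⁻; ∈-++⁺ˡ; ∈-++⁺ʳ; ∈-concat⁺′; ∈-concat⁻′; ∈-filter⁺; ∈-filter⁻)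
open import Data.List.NonEmpty.Base using (toList) renaming (_∷_ to _∷⁺_)
open import Data.List.Relation.Unary.All using (All; []; _∷_)
import Data.List.Relation.Unary.All as All
open import Data.List.Relation.Unary.All.Properties using (all⁺; all⁻; tabulate⁻)
import Data.List.Relation.Unary.All.Properties as Allₚ
open import Data.List.Relation.Unary.Any using (Any; here; there; satisfied)
import Data.List.Relation.Unary.Any as Any
open import Data.List.Relation.Unary.Any.Properties using (any⁺; any⁻; lookup-index)
import Data.List.Relation.Unary.Any.Properties as Anyₚ
open import Data.Nat.Base
  using (ℕ; zero; suc; _+_; _*_; _^_; _≤_; _<_; _≡ᵇ_; ⌊_/2⌋; z≤n; s≤s; z<s; s<s)
open import Data.Nat.ListAction using (sum)
open import Data.Nat.Properties
  using ( +-assoc; +-comm; +-identityʳ; +-suc; *-distribʳ-+; n≡⌊n+n/2⌋; _<?_; ≡ᵇ⇒≡; ≡⇒≡ᵇ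
        ; ≤-refl; ≤-reflexive; ≤-trans; ≤-<-trans; <-irrefl; <⇒≢; <⇒≱; ≮⇒≥; ≰⇒>
        ; n≤1+n; m≤n⇒m≤1+n
        ; m≤m+n; m≤n+m; m<m+n; m<n+m; +-mono-≤; +-monoʳ-≤; +-monoʳ-<; *-monoˡ-≤
        ; m^n>0; ^-monoʳ-≤; ^-monoʳ-<; module ≤-Reasoning )
open import Data.Product.Base using (Σ; ∃; ∃₂; _×_; _,_; proj₁; proj₂)
open import Data.Sum.Base using (_⊎_; inj₁; inj₂)
import Data.Sum.Properties as Sum
import Data.Vec.Base as Vec
import Data.Vec.Properties as Vecₚ
open import Function.Base using (_∘_; id; case_of_)
open import Function.Bundles using (_⇔_; mk⇔; Equivalence)
import Function.Properties.Equivalence as Equiv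
open import Relation.Binary.Definitions using (DecidableEquality)
open import Relation.Binary.PropositionalEquality
  using (_≡_; refl; sym; trans; cong; cong₂; subst; module ≡-Reasoning)
open import Relation.Nullary using (¬_; Dec; yes; no; does; ¬?)
open import Relation.Nullary.Decidable using (_×-dec_; dec-true; toWitness; fromWitness; ⌊_⌋)
open import Relation.Unary using (Pred; Decidable)

-- Binary expansions and powers of two

infixr 5 _∷ᵇ_

_∷ᵇ_ : Bool → ℕ → ℕ
false ∷ᵇ h = h + h
true  ∷ᵇ h = suc (h + h)

∷ᵇ-split : ∀ N → ∃₂ λ b h → N ≡ b ∷ᵇ h
∷ᵇ-split zero = false , 0 , refl
∷ᵇ-split (suc N) with ∷ᵇ-split N
... | false , h , refl = true , h , refl
... | true  , h , refl = false , suc h , cong suc (sym (+-suc h h))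

bitAt-zero-∷ᵇ : ∀ b h → bitAt zero (b ∷ᵇ h) ≡ b
bitAt-zero-∷ᵇ false zero = refl
bitAt-zero-∷ᵇ true  zero = refl
bitAt-zero-∷ᵇ false (suc h) rewrite +-suc h h = bitAt-zero-∷ᵇ false h
bitAt-zero-∷ᵇ true  (suc h) rewrite +-suc h h = bitAt-zero-∷ᵇ true h

⌊∷ᵇ/2⌋ : ∀ b h → ⌊ b ∷ᵇ h /2⌋ ≡ h
⌊∷ᵇ/2⌋ false h = sym (n≡⌊n+n/2⌋ h)
⌊∷ᵇ/2⌋ true zero = refl
⌊∷ᵇ/2⌋ true (suc h) rewrite +-suc h h = cong suc (⌊∷ᵇ/2⌋ true h)

bitAt-suc-∷ᵇ : ∀ b h i → bitAt (suc i) (b ∷ᵇ h) ≡ bitAt i h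
bitAt-suc-∷ᵇ b h i = cong (bitAt i) (⌊∷ᵇ/2⌋ b h)

2^-suc : ∀ n → 2 ^ suc n ≡ 2 ^ n + 2 ^ n
2^-suc n = cong (2 ^ n +_) (+-identityʳ (2 ^ n))

n<2^n : ∀ n → n < 2 ^ n
n<2^n zero = z<s
n<2^n (suc n) = begin-strict
  suc n         ≤⟨ n<2^n n ⟩
  2 ^ n         <⟨ m<m+n (2 ^ n) (m^n>0 2 n) ⟩
  2 ^ n + 2 ^ n ≡⟨ 2^-suc n ⟨
  2 ^ suc n     ∎
  where open ≤-Reasoning

∷ᵇ-<-2^ : ∀ b h n → b ∷ᵇ h < 2 ^ suc n → h < 2 ^ n
∷ᵇ-<-2^ b h n lt = ≰⇒> λ 2^n≤h → <⇒≱ lt (begin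
  2 ^ suc n     ≡⟨ 2^-suc n ⟩
  2 ^ n + 2 ^ n ≤⟨ +-mono-≤ 2^n≤h 2^n≤h ⟩
  h + h         ≤⟨ low b ⟩
  b ∷ᵇ h        ∎)
  where
  open ≤-Reasoning
  low : ∀ b → h + h ≤ b ∷ᵇ h
  low false = ≤-refl
  low true  = n≤1+n (h + h)

bits-injective : ∀ n {M N} → M < 2 ^ n → N < 2 ^ n →
                 (∀ i → i < n → bitAt i M ≡ bitAt i N) → M ≡ N
bits-injective zero {zero} {zero} _ _ _ = refl
bits-injective zero {suc _} (s<s ())
bits-injective zero {N = suc _} _ (s<s ())
bits-injective (suc n) {M} {N} M< N< same
  with ∷ᵇ-split M | ∷ᵇ-split N
... | b , h , refl | c , h′ , refl =
  cong₂ _∷ᵇ_ lowest (bits-injective n (∷ᵇ-<-2^ b h n M<) (∷ᵇ-<-2^ c h′ n N<) higher)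
  where
  lowest : b ≡ c
  lowest = trans (sym (bitAt-zero-∷ᵇ b h)) (trans (same 0 z<s) (bitAt-zero-∷ᵇ c h′))
  higher : ∀ i → i < n → bitAt i h ≡ bitAt i h′
  higher i i<n = trans (sym (bitAt-suc-∷ᵇ b h i))
                  (trans (same (suc i) (s<s i<n)) (bitAt-suc-∷ᵇ c h′ i))

bitAt-zero : ∀ i → bitAt i 0 ≡ false
bitAt-zero zero    = refl
bitAt-zero (suc i) = bitAt-zero i

bitAt-2^ : ∀ p i → bitAt i (2 ^ p) ≡ (i ≡ᵇ p)
bitAt-2^ zero zero    = refl
bitAt-2^ zero (suc i) = bitAt-zero i
bitAt-2^ (suc p) zero    rewrite 2^-suc p = bitAt-zero-∷ᵇ false (2 ^ p)
bitAt-2^ (suc p) (suc i) rewrite 2^-suc p = trans (bitAt-suc-∷ᵇ false (2 ^ p) i) (bitAt-2^ p i)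

-- max denotes the length of the word, since positions are numbered from 1.
isPowerOfTwoLength : ∀ {k v} → Formula k v
isPowerOfTwoLength =
  ex (bit (var zero) max and fa (neg (bit (var zero) max) or (var zero ≐ var (suc zero))))

BIT-max : ∀ {n} (p : Fin (suc n)) → BIT p (fromℕ n) ≡ bitAt (toℕ p) (suc n)
BIT-max {n} p = cong (λ m → bitAt (toℕ p) (suc m)) (toℕ-fromℕ n)

T-not∨⇒≡ : ∀ {b e} → T (not b ∨ e) → (T e → T b) → b ≡ e
T-not∨⇒≡ {true}  {true}  _ _ = refl
T-not∨⇒≡ {false} {false} _ _ = refl
T-not∨⇒≡ {false} {true}  _ e⇒b with () ← e⇒b _

eval-isPowerOfTwoLength : ∀ {k v} n (w : Fin (suc n) → Fin k) ρ →
  T (eval {v = v} n w ρ isPowerOfTwoLength) ⇔ ∃ λ p → suc n ≡ 2 ^ p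
eval-isPowerOfTwoLength n w ρ = mk⇔ to from
  where
  N = suc n
  to : T (eval n w ρ isPowerOfTwoLength) → ∃ λ p → N ≡ 2 ^ p
  to holds with satisfied (any⁻ _ (allFin N) holds)
  ... | p , holds-p with Equivalence.to T-∧ holds-p
  ... | bit-p , others = toℕ p , bits-injective N (n<2^n N) 2^p<2^N agree
    where
    2^p<2^N : 2 ^ toℕ p < 2 ^ N
    2^p<2^N = ^-monoʳ-< 2 (s≤s (s≤s z≤n)) (toℕ<n p)
    onlyBit : ∀ q → bitAt (toℕ q) N ≡ (toℕ q ≡ᵇ toℕ p)
    onlyBit q = T-not∨⇒≡
      (subst (λ b → T (not b ∨ (toℕ q ≡ᵇ toℕ p))) (BIT-max q)
        (tabulate⁻ {f = id} (all⁺ _ _ others) q))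
      (λ q≡p → subst (λ j → T (bitAt j N)) (sym (≡ᵇ⇒≡ (toℕ q) (toℕ p) q≡p))
        (subst T (BIT-max p) bit-p))
    agree : ∀ i → i < N → bitAt i N ≡ bitAt i (2 ^ toℕ p)
    agree i i<N = subst (λ j → bitAt j N ≡ bitAt j (2 ^ toℕ p)) (toℕ-fromℕ< i<N)
      (trans (onlyBit (fromℕ< i<N)) (sym (bitAt-2^ (toℕ p) (toℕ (fromℕ< i<N)))))
  from : (∃ λ p → N ≡ 2 ^ p) → T (eval n w ρ isPowerOfTwoLength)
  from (x , N≡2^x) =
    any⁺ _ (Anyₚ.tabulate⁺ {f = id} p
      (Equivalence.from T-∧ (bit-p , all⁻ _ (Allₚ.tabulate⁺ {f = id} others))))
    where
    x<N : x < N
    x<N = subst (x <_) (sym N≡2^x) (n<2^n x)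
    p = fromℕ< x<N
    bits : ∀ q → BIT q (fromℕ n) ≡ (toℕ q ≡ᵇ x)
    bits q = trans (BIT-max q) (trans (cong (bitAt (toℕ q)) N≡2^x) (bitAt-2^ x (toℕ q)))
    bit-p : T (BIT p (fromℕ n))
    bit-p = subst T (sym (bits p)) (≡⇒≡ᵇ _ _ (toℕ-fromℕ< x<N))
    others : ∀ q → T (not (BIT q (fromℕ n)) ∨ (toℕ q ≡ᵇ toℕ p))
    others q rewrite bits q | toℕ-fromℕ< x<N | ∨-inverseˡ (toℕ q ≡ᵇ x) = _

letterAmong : ∀ {k} → List (Fin k) → Formula k 1
letterAmong []       = min ≺ min    -- false
letterAmong (b ∷ bs) = letter b (var zero) or letterAmong bs

eval-letterAmong : ∀ {k} n (w : Fin (suc n) → Fin k) i bs →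
                   T (eval n w (λ _ → i) (letterAmong bs)) ⇔ w i ∈ bs
eval-letterAmong n w i bs = mk⇔ (to bs) (from bs)
  where
  to : ∀ bs → T (eval n w (λ _ → i) (letterAmong bs)) → w i ∈ bs
  to []       ()
  to (b ∷ bs) holds with Equivalence.to T-∨ holds
  ... | inj₁ wi≡b = here (toℕ-injective (≡ᵇ⇒≡ (toℕ (w i)) (toℕ b) wi≡b))
  ... | inj₂ rest = there (to bs rest)
  from : ∀ bs → w i ∈ bs → T (eval n w (λ _ → i) (letterAmong bs))
  from (b ∷ bs) (here refl)   = Equivalence.from T-∨ (inj₁ (≡⇒≡ᵇ (toℕ b) (toℕ b) refl))
  from (b ∷ bs) (there wi∈bs) = Equivalence.from T-∨ (inj₂ (from bs wi∈bs))

-- Letters sent by h to the last element satisfy no formula: that is the default of leastTrue.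
classify : ∀ {k t} → (Fin k → Fin (suc t)) → Fin t → Formula k 1
classify h j = letterAmong (filter (λ b → h b ≟ inject₁ j) (allFin _))

eval-classify : ∀ {k t} (h : Fin k → Fin (suc t)) n w i j →
                T (eval n w (λ _ → i) (classify h j)) ⇔ h (w i) ≡ inject₁ j
eval-classify {k} h n w i j = mk⇔
  (proj₂ ∘ ∈-filter⁻ (λ b → h b ≟ inject₁ j) {xs = allFin k}
         ∘ Equivalence.to (eval-letterAmong n w i letters))
  (Equivalence.from (eval-letterAmong n w i letters)
    ∘ ∈-filter⁺ (λ b → h b ≟ inject₁ j) (∈-allFin (w i)))
  where letters = filter (λ b → h b ≟ inject₁ j) (allFin k)

leastTrue-unique : ∀ {t} (f : Fin t → Bool) c → (∀ j → T (f j) ⇔ c ≡ inject₁ j) → leastTrue f ≡ c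
leastTrue-unique {zero} f zero spec = refl
leastTrue-unique {suc t} f c spec with f zero in f0
leastTrue-unique {suc t} f zero    spec | true  = refl
leastTrue-unique {suc t} f (suc c) spec | true  with () ← Equivalence.to (spec zero) (subst T (sym f0) _)
leastTrue-unique {suc t} f zero    spec | false with () ← subst T f0 (Equivalence.from (spec zero) refl)
leastTrue-unique {suc t} f (suc c) spec | false =
  cong suc (leastTrue-unique (f ∘ suc) c λ j →
    mk⇔ (suc-injective ∘ Equivalence.to (spec (suc j))) (Equivalence.from (spec (suc j)) ∘ cong suc))

inducedWord-classify : ∀ {k t} (h : Fin k → Fin (suc t)) x xs →
                       inducedWord (length xs) (lookup (x ∷ xs)) (classify h) ≡ map h (x ∷ xs)
inducedWord-classify h x xs = begin
  inducedWord (length xs) w (classify h)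
    ≡⟨ tabulate-cong (λ i → leastTrue-unique _ (h (w i)) (eval-classify h _ w i)) ⟩
  tabulate (h ∘ w)
    ≡⟨ map-tabulate w h ⟨
  map h (tabulate w)
    ≡⟨ cong (map h) (tabulate-lookup (x ∷ xs)) ⟩
  map h (x ∷ xs)
    ∎
  where
  open ≡-Reasoning
  w = lookup (x ∷ xs)

first : ∀ {g} → Op g
first x _ = x

evaluates-first⁺ : ∀ {g} (x : Fin g) xs → Evaluates first (x ∷ xs) x
evaluates-first⁺ x []       = leaf x
evaluates-first⁺ x (y ∷ xs) = node (leaf x) (evaluates-first⁺ y xs)

evaluates-first⁻ : ∀ {g} {cs} {x : Fin g} → Evaluates first cs x → ∃ λ rest → cs ≡ x ∷ rest
evaluates-first⁻ (leaf x) = [] , refl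
evaluates-first⁻ (node {v = v} e₁ _) with evaluates-first⁻ e₁
... | rest , refl = rest ++ v , refl

wordProblem-first : ∀ {g} (S : Fin g → Bool) c cs → WordProblem first S (c ∷ cs) ⇔ T (S c)
wordProblem-first S c cs = mk⇔
  (λ { (x , Sx , ev) → case evaluates-first⁻ ev of λ { (_ , refl) → Sx } })
  (λ Sc → c , Sc , evaluates-first⁺ c cs)

HoldsAtMin : ∀ {k} → Formula k 1 → Language k
HoldsAtMin φ []       = ⊥
HoldsAtMin φ (x ∷ xs) = T (eval (length xs) (lookup (x ∷ xs)) (λ _ → zero) φ)

holdsAtMin-QGrpFObit : ∀ {k} (φ : Formula k 1) → IsQGrpFObit (HoldsAtMin φ)
holdsAtMin-QGrpFObit φ = 1 , first , isZero , (λ _ → φ) , (λ ()) , λ x xs →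
  Equiv.trans (isZero-leastTrue _) (Equiv.sym (wordProblem-first isZero _ _))
  where
  isZero : Fin 2 → Bool
  isZero zero    = true
  isZero (suc _) = false
  isZero-leastTrue : ∀ b → T b ⇔ T (isZero (leastTrue {1} λ _ → b))
  isZero-leastTrue true  = mk⇔ id id
  isZero-leastTrue false = mk⇔ (λ ()) (λ ())

module _ {m : ℕ} where

  ⟪_⟫ : ∀ {ℓ} {P : Pred (Fin m) ℓ} → Decidable P → Subset m
  ⟪ P? ⟫ = Vec.tabulate (does ∘ P?)

  ∈⟪⟫⁺ : ∀ {ℓ} {P : Pred (Fin m) ℓ} (P? : Decidable P) {q} → P q → q ∈ˢ ⟪ P? ⟫
  ∈⟪⟫⁺ P? {q} Pq = Vecₚ.lookup⇒[]= q _ (trans (Vecₚ.lookup∘tabulate _ q) (dec-true (P? q) Pq))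

  ∈⟪⟫⁻ : ∀ {ℓ} {P : Pred (Fin m) ℓ} (P? : Decidable P) {q} → q ∈ˢ ⟪ P? ⟫ → P q
  ∈⟪⟫⁻ P? {q} q∈ with P? q | trans (sym (Vecₚ.lookup∘tabulate (does ∘ P?) q)) (Vecₚ.[]=⇒lookup q∈)
  ... | yes Pq | _  = Pq
  ... | no _   | ()

module Closure {m : ℕ} (new : Subset m → Subset m) where

  step : Subset m → Subset m
  step X = X ∪ new X

  Closed : Subset m → Set
  Closed X = new X ⊆ X

  iterate : ℕ → Subset m → Subset m
  iterate zero    X = X
  iterate (suc f) X with ∣ X ∣ <? ∣ step X ∣
  ... | yes _ = iterate f (step X)
  ... | no  _ = X

  closure : Subset m → Subset m
  closure = iterate (suc m)

  step-grows : ∀ {X q} → q ∈ˢ new X → q ∉ˢ X → ∣ X ∣ < ∣ step X ∣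
  step-grows {X} q∈new q∉X = p⊂q⇒∣p∣<∣q∣ (p⊆p∪q (new X) , _ , x∈p∪q⁺ (inj₂ q∈new) , q∉X)

  stuck-closed : ∀ {X} → ¬ ∣ X ∣ < ∣ step X ∣ → Closed X
  stuck-closed {X} stuck {q} q∈new with q ∈ˢ? X
  ... | yes q∈X = q∈X
  ... | no q∉X  = ⊥-elim (stuck (step-grows q∈new q∉X))

  iterate-closed : ∀ f X → m < f + ∣ X ∣ → Closed (iterate f X)
  iterate-closed zero X m<∣X∣ = ⊥-elim (<⇒≱ m<∣X∣ (∣p∣≤n X))
  iterate-closed (suc f) X m< with ∣ X ∣ <? ∣ step X ∣
  ... | yes grows = iterate-closed f (step X)
                      (≤-trans m< (≤-trans (≤-reflexive (sym (+-suc f ∣ X ∣))) (+-monoʳ-≤ f grows)))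
  ... | no stuck  = stuck-closed stuck

  closure-closed : ∀ X → Closed (closure X)
  closure-closed X = iterate-closed (suc m) X (s≤s (m≤m+n m ∣ X ∣))

  iterate-⊇ : ∀ f X → X ⊆ iterate f X
  iterate-⊇ zero X q∈ = q∈
  iterate-⊇ (suc f) X q∈ with ∣ X ∣ <? ∣ step X ∣
  ... | yes _ = iterate-⊇ f (step X) (x∈p∪q⁺ (inj₁ q∈))
  ... | no  _ = q∈

  closure-⊇ : ∀ X → X ⊆ closure X
  closure-⊇ = iterate-⊇ (suc m)

  iterate-induction : (P : Subset m → Set) → (∀ {X} → P X → P (step X)) →
                      ∀ f {X} → P X → P (iterate f X)
  iterate-induction P P-step zero PX = PX
  iterate-induction P P-step (suc f) {X} PX with ∣ X ∣ <? ∣ step X ∣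
  ... | yes _ = iterate-induction P P-step f (P-step PX)
  ... | no  _ = PX

  closure-induction : (P : Subset m → Set) → (∀ {X} → P X → P (step X)) →
                      ∀ {X} → P X → P (closure X)
  closure-induction P P-step = iterate-induction P P-step (suc m)

boolToFin : Bool → Fin 2
boolToFin false = zero
boolToFin true  = suc zero

finToBool : Fin 2 → Bool
finToBool zero       = false
finToBool (suc zero) = true

finToBool-boolToFin : ∀ b → finToBool (boolToFin b) ≡ b
finToBool-boolToFin false = refl
finToBool-boolToFin true  = refl

module _ {m : ℕ} where

  -- The element zero of Fin (1 + 2 ^ m) is junk: it decodes to the empty set.
  encode : Subset m → Fin (suc (2 ^ m))
  encode X = suc (funToFin (boolToFin ∘ Vec.lookup X))

  decode : Fin (suc (2 ^ m)) → Subset m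
  decode zero    = ∅
  decode (suc c) = Vec.tabulate (finToBool ∘ finToFun c)

  decode-encode : ∀ X → decode (encode X) ≡ X
  decode-encode X = begin
    Vec.tabulate (finToBool ∘ finToFun (funToFin (boolToFin ∘ Vec.lookup X)))
      ≡⟨ Vecₚ.tabulate-cong (λ q → cong finToBool (finToFun-funToFin (boolToFin ∘ Vec.lookup X) q)) ⟩
    Vec.tabulate (finToBool ∘ boolToFin ∘ Vec.lookup X)
      ≡⟨ Vecₚ.tabulate-cong (finToBool-boolToFin ∘ Vec.lookup X) ⟩
    Vec.tabulate (Vec.lookup X)
      ≡⟨ Vecₚ.tabulate∘lookup X ⟩
    X ∎
    where open ≡-Reasoning

-- The groupoid of a context-free grammar

map-++⁻ : ∀ {A B : Set} (f : A → B) (w : List A) {u v} → map f w ≡ u ++ v →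
          ∃₂ λ w₁ w₂ → w ≡ w₁ ++ w₂ × map f w₁ ≡ u × map f w₂ ≡ v
map-++⁻ f w {[]} refl = [] , w , refl , refl , refl
map-++⁻ f (x ∷ w) {_ ∷ u} {v} eq with map-++⁻ f w {u} {v} (∷-injectiveʳ eq)
... | w₁ , w₂ , refl , refl , refl = x ∷ w₁ , w₂ , refl , cong (_∷ map f w₁) (∷-injectiveˡ eq) , refl

tails-tail : ∀ {A : Set} {x : A} {xs ys} → x ∷ xs ∈ tails ys → xs ∈ tails ys
tails-tail {ys = y ∷ ys} (here refl) = there (here refl)
tails-tail {ys = y ∷ ys} (there t∈) = there (tails-tail t∈)

module _ {k} {G : CFG k} where

  mutual
    derives-nonempty : ∀ {A w} → Derives G A w → 1 ≤ length w
    derives-nonempty (rule {rhs = _ ∷⁺ _} _ ds) = derivesSeq-nonempty (s≤s z≤n) ds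

    derivesSeq-nonempty : ∀ {ss w} → 1 ≤ length ss → DerivesSeq G ss w → 1 ≤ length w
    derivesSeq-nonempty _ (term _) = s≤s z≤n
    derivesSeq-nonempty _ (nont {u = u} {v} d _) =
      ≤-trans (derives-nonempty d) (≤-trans (m≤m+n (length u) (length v)) (≤-reflexive (sym (length-++ u))))

module GrammarGroupoid {k : ℕ} (G : CFG k) where

  Form : Set
  Form = List (Symbol (#N G) k)

  _≟ᶠ_ : DecidableEquality Form
  _≟ᶠ_ = ≡-dec (Sum.≡-dec _≟_ _≟_)

  rhsTails : List Form
  rhsTails = concatMap (tails ∘ toList ∘ proj₂) (rules G)

  symbolForms : List Form
  symbolForms = map [_] (map inj₁ (allFin (#N G)) ++ map inj₂ (allFin k))

  forms : List Form
  forms = symbolForms ++ rhsTails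

  m : ℕ
  m = length forms

  form : Fin m → Form
  form = lookup forms

  rhs∈rhsTails : ∀ {A rhs} → (A , rhs) ∈ rules G → toList rhs ∈ rhsTails
  rhs∈rhsTails r∈ = ∈-concat⁺′ (here refl) (∈-map⁺ (tails ∘ toList ∘ proj₂) r∈)

  rhsTails-tail : ∀ {s ss} → s ∷ ss ∈ rhsTails → ss ∈ rhsTails
  rhsTails-tail t∈ with ∈-concat⁻′ (map (tails ∘ toList ∘ proj₂) (rules G)) t∈
  ... | xs , t∈xs , xs∈ with ∈-map⁻ (tails ∘ toList ∘ proj₂) {xs = rules G} xs∈
  ... | r , r∈ , xs≡ =
    ∈-concat⁺′ (tails-tail (subst (_ ∈_) xs≡ t∈xs)) (∈-map⁺ (tails ∘ toList ∘ proj₂) r∈)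

  nonterminal∈forms : ∀ A → [ inj₁ A ] ∈ forms
  nonterminal∈forms A = ∈-++⁺ˡ (∈-map⁺ [_] (∈-++⁺ˡ (∈-map⁺ inj₁ (∈-allFin A))))

  terminal∈forms : ∀ a → [ inj₂ a ] ∈ forms
  terminal∈forms a =
    ∈-++⁺ˡ (∈-map⁺ [_] (∈-++⁺ʳ (map inj₁ (allFin (#N G))) (∈-map⁺ inj₂ (∈-allFin a))))

  rhsTail∈forms : ∀ {f} → f ∈ rhsTails → f ∈ forms
  rhsTail∈forms = ∈-++⁺ʳ symbolForms

  infix 4 _∋ᶠ_ _∋ᶠ?_

  -- forms may list a form several times; X ∋ᶠ f asks for some index of f.
  _∋ᶠ_ : Subset m → Form → Set
  X ∋ᶠ f = ∃ λ q → form q ≡ f × q ∈ˢ X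

  _∋ᶠ?_ : ∀ X f → Dec (X ∋ᶠ f)
  X ∋ᶠ? f = any? (λ q → (form q ≟ᶠ f) ×-dec (q ∈ˢ? X))

  ∋ᶠ-mono : ∀ {X Y f} → X ⊆ Y → X ∋ᶠ f → Y ∋ᶠ f
  ∋ᶠ-mono X⊆Y (q , refl , q∈X) = q , refl , X⊆Y q∈X

  select : ∀ {ℓ} {Q : Pred Form ℓ} → Decidable Q → Subset m
  select Q? = ⟪ Q? ∘ form ⟫

  select-∋⁺ : ∀ {ℓ} {Q : Pred Form ℓ} (Q? : Decidable Q) {f} → f ∈ forms → Q f → select Q? ∋ᶠ f
  select-∋⁺ {Q = Q} Q? f∈ Qf =
    Any.index f∈ , sym (lookup-index f∈) , ∈⟪⟫⁺ (Q? ∘ form) (subst Q (lookup-index f∈) Qf)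

  select-∋⁻ : ∀ {ℓ} {Q : Pred Form ℓ} (Q? : Decidable Q) {f} → select Q? ∋ᶠ f → Q f
  select-∋⁻ Q? (q , refl , q∈) = ∈⟪⟫⁻ (Q? ∘ form) q∈

  Produces : Subset m → Pred Form _
  Produces X f = Any (λ r → f ≡ [ inj₁ (proj₁ r) ] × X ∋ᶠ toList (proj₂ r)) (rules G)

  produces? : ∀ X → Decidable (Produces X)
  produces? X f =
    Any.any? (λ r → (f ≟ᶠ [ inj₁ (proj₁ r) ]) ×-dec (X ∋ᶠ? toList (proj₂ r))) (rules G)

  Joins : Subset m → Subset m → Pred Form _
  Joins X Y []       = ⊥
  Joins X Y (s ∷ ss) = X ∋ᶠ [ s ] × Y ∋ᶠ ss

  joins? : ∀ X Y → Decidable (Joins X Y)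
  joins? X Y []       = no λ ()
  joins? X Y (s ∷ ss) = (X ∋ᶠ? [ s ]) ×-dec (Y ∋ᶠ? ss)

  open Closure (λ X → select (produces? X))

  join : Subset m → Subset m → Subset m
  join X Y = closure (select (joins? X Y))

  leafSet : Fin k → Subset m
  leafSet a = closure (select (_≟ᶠ [ inj₂ a ]))

  _·_ : Op (suc (2 ^ m))
  c · d = encode (join (decode c) (decode d))

  leafValue : Fin k → Fin (suc (2 ^ m))
  leafValue a = encode (leafSet a)

  accepting : Fin (suc (2 ^ m)) → Bool
  accepting c = ⌊ decode c ∋ᶠ? [ inj₁ (start G) ] ⌋

  derivesSeq-[A]⁺ : ∀ {A w} → Derives G A w → DerivesSeq G [ inj₁ A ] w
  derivesSeq-[A]⁺ {w = w} d = subst (DerivesSeq G _) (++-identityʳ w) (nont d [])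

  derivesSeq-[A]⁻ : ∀ {A w} → DerivesSeq G [ inj₁ A ] w → Derives G A w
  derivesSeq-[A]⁻ (nont {u = u} d []) = subst (Derives G _) (sym (++-identityʳ u)) d

  derivesSeq-∷ : ∀ {s ss u v} → DerivesSeq G [ s ] u → DerivesSeq G ss v → DerivesSeq G (s ∷ ss) (u ++ v)
  derivesSeq-∷ (term [])   ds = term ds
  derivesSeq-∷ (nont {u = u} d []) ds = subst (λ x → DerivesSeq G _ (x ++ _)) (sym (++-identityʳ u)) (nont d ds)

  Sound : Subset m → Word k → Set
  Sound X w = ∀ {f} → X ∋ᶠ f → DerivesSeq G f w

  step-sound : ∀ {X w} → Sound X w → Sound (step X) w
  step-sound {X} sound (q , refl , q∈) with x∈p∪q⁻ X _ q∈
  ... | inj₁ q∈X = sound (q , refl , q∈X)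
  ... | inj₂ q∈new with find (∈⟪⟫⁻ (produces? X ∘ form) q∈new)
  ...   | (A , rhs) , r∈ , f≡ , X∋rhs =
    subst (λ f → DerivesSeq G f _) (sym f≡) (derivesSeq-[A]⁺ (rule r∈ (sound X∋rhs)))

  closure-sound : ∀ {X w} → Sound X w → Sound (closure X) w
  closure-sound {w = w} = closure-induction (λ X → Sound X w) step-sound

  join-sound : ∀ {X Y u v} → Sound X u → Sound Y v → Sound (join X Y) (u ++ v)
  join-sound {X} {Y} soundX soundY = closure-sound sound
    where
    sound : Sound (select (joins? X Y)) _
    sound {s ∷ ss} sel with select-∋⁻ (joins? X Y) sel
    ... | X∋s , Y∋ss = derivesSeq-∷ (soundX X∋s) (soundY Y∋ss)
    sound {[]} sel = ⊥-elim (select-∋⁻ (joins? X Y) sel)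

  leafSet-sound : ∀ a → Sound (leafSet a) [ a ]
  leafSet-sound a = closure-sound λ sel →
    subst (λ f → DerivesSeq G f _) (sym (select-∋⁻ (_≟ᶠ [ inj₂ a ]) sel)) (term [])

  evaluates-sound : ∀ {cs c} → Evaluates _·_ cs c → ∀ w → cs ≡ map leafValue w → Sound (decode c) w
  evaluates-sound (leaf _) (a ∷ []) refl =
    subst (λ X → Sound X [ a ]) (sym (decode-encode (leafSet a))) (leafSet-sound a)
  evaluates-sound (node {x = x} {y} e₁ e₂) w cs≡ with map-++⁻ leafValue w (sym cs≡)
  ... | w₁ , w₂ , refl , u≡ , v≡ =
    subst (λ X → Sound X (w₁ ++ w₂)) (sym (decode-encode (join (decode x) (decode y))))
      (join-sound (evaluates-sound e₁ w₁ (sym u≡)) (evaluates-sound e₂ w₂ (sym v≡)))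

  Value : Word k → Form → Set
  Value w f = ∃ λ c → Evaluates _·_ (map leafValue w) c × Closed (decode c) × decode c ∋ᶠ f

  closure-value : ∀ {w f} X → Evaluates _·_ (map leafValue w) (encode (closure X)) → X ∋ᶠ f → Value w f
  closure-value {f = f} X ev X∋f =
    encode (closure X) , ev ,
    subst Closed (sym (decode-encode (closure X))) (closure-closed X) ,
    subst (_∋ᶠ f) (sym (decode-encode (closure X))) (∋ᶠ-mono (closure-⊇ X) X∋f)

  leaf-value : ∀ a → Value [ a ] [ inj₂ a ]
  leaf-value a = closure-value _ (leaf (leafValue a)) (select-∋⁺ (_≟ᶠ [ inj₂ a ]) (terminal∈forms a) refl)

  rule-value : ∀ {A rhs w} → (A , rhs) ∈ rules G → Value w (toList rhs) → Value w [ inj₁ A ]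
  rule-value {A} r∈ (c , ev , closed , c∋rhs) =
    c , ev , closed ,
    ∋ᶠ-mono closed (select-∋⁺ (produces? (decode c)) (nonterminal∈forms A) (lose r∈ (refl , c∋rhs)))

  node-value : ∀ {s ss u v} → s ∷ ss ∈ forms → Value u [ s ] → Value v ss → Value (u ++ v) (s ∷ ss)
  node-value {u = u} {v} t∈ (c , ev₁ , _ , c∋s) (d , ev₂ , _ , d∋ss) =
    closure-value _ (subst (λ cs → Evaluates _·_ cs (c · d)) (sym (map-++ leafValue u v)) (node ev₁ ev₂))
      (select-∋⁺ (joins? (decode c) (decode d)) t∈ (c∋s , d∋ss))

  mutual
    derives-value : ∀ {A w} → Derives G A w → Value w [ inj₁ A ]
    derives-value (rule r∈ ds) = rule-value r∈ (derivesSeq-value (rhs∈rhsTails r∈) ds)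

    derivesSeq-value : ∀ {s ss w} → s ∷ ss ∈ rhsTails → DerivesSeq G (s ∷ ss) w → Value w (s ∷ ss)
    derivesSeq-value {ss = []} _ (term {a = a} []) = leaf-value a
    derivesSeq-value {ss = []} _ (nont {u = u} d []) =
      subst (λ w → Value w _) (sym (++-identityʳ u)) (derives-value d)
    derivesSeq-value {ss = _ ∷ _} t∈ (term {a = a} ds) =
      node-value (rhsTail∈forms t∈) (leaf-value a) (derivesSeq-value (rhsTails-tail t∈) ds)
    derivesSeq-value {ss = _ ∷ _} t∈ (nont d ds) =
      node-value (rhsTail∈forms t∈) (derives-value d) (derivesSeq-value (rhsTails-tail t∈) ds)

  wordProblem⇔langOf : ∀ w → WordProblem _·_ accepting (map leafValue w) ⇔ LangOf G w
  wordProblem⇔langOf w = mk⇔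
    (λ (c , acc , ev) → derivesSeq-[A]⁻ (evaluates-sound ev w refl (toWitness acc)))
    (λ D → let c , ev , _ , c∋S = derives-value D in c , fromWitness c∋S , ev)

cfl⇒QGrpFObit : ∀ {k} (L : Language k) → IsCFL L → IsQGrpFObit L
cfl⇒QGrpFObit {k} L (G , L⇔G) = 2 ^ m , _·_ , accepting , classify leafValue , ε∉L , λ x xs →
  subst (λ cs → L (x ∷ xs) ⇔ WordProblem _·_ accepting cs) (sym (inducedWord-classify leafValue x xs))
    (Equiv.trans (L⇔G (x ∷ xs)) (Equiv.sym (wordProblem⇔langOf (x ∷ xs))))
  where
  open GrammarGroupoid G
  ε∉L : ¬ L []
  ε∉L ε∈L with () ← derives-nonempty (Equivalence.to (L⇔G []) ε∈L)

∈⇒≤sum : ∀ {n ns} → n ∈ ns → n ≤ sum ns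
∈⇒≤sum {ns = m ∷ ms} (here refl) = m≤m+n m (sum ms)
∈⇒≤sum {ns = m ∷ ms} (there n∈) = ≤-trans (∈⇒≤sum n∈) (m≤n+m (sum ms) m)

-- Pumping unary grammars

+-<-cancel : ∀ {a b x y} → a + x < b + y → b ≤ a → x < y
+-<-cancel lt b≤a = ≰⇒> λ y≤x → <⇒≱ lt (+-mono-≤ b≤a y≤x)

ones : ℕ → Word 1
ones l = replicate l zero

ones-length : ∀ (w : Word 1) → w ≡ ones (length w)
ones-length []       = refl
ones-length (zero ∷ w) = cong (zero ∷_) (ones-length w)

ones-++ : ∀ a b → ones a ++ ones b ≡ ones (a + b)
ones-++ zero    b = refl
ones-++ (suc a) b = cong (zero ∷_) (ones-++ a b)

module UnaryPumping (G : CFG 1) where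

  S = start G

  M : ℕ
  M = suc (sum (map (length ∘ toList ∘ proj₂) (rules G)))

  rhs-length≤M : ∀ {A rhs} → (A , rhs) ∈ rules G → length (toList rhs) ≤ M
  rhs-length≤M r∈ = m≤n⇒m≤1+n (∈⇒≤sum (∈-map⁺ (length ∘ toList ∘ proj₂) r∈))

  Yields : Fin (#N G) → ℕ → Set
  Yields A l = Derives G A (ones l)

  YieldsSeq : List (Symbol (#N G) 1) → ℕ → Set
  YieldsSeq ss l = DerivesSeq G ss (ones l)

  -- Over a one-letter alphabet a context u [ ] v is described by its width |uv|.
  infix 4 _⇝[_]_
  _⇝[_]_ : (ℕ → Set) → ℕ → (ℕ → Set) → Set
  P ⇝[ e ] Q = ∀ l → P l → Q (l + e)

  ⇝-refl : ∀ {P} → P ⇝[ 0 ] P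
  ⇝-refl {P} l p = subst P (sym (+-identityʳ l)) p

  ⇝-trans : ∀ {P Q R e f} → P ⇝[ e ] Q → Q ⇝[ f ] R → P ⇝[ e + f ] R
  ⇝-trans {R = R} {e} {f} pq qr l p = subst R (+-assoc l e f) (qr (l + e) (pq l p))

  ⇝-iterate : ∀ {P e l} → P ⇝[ e ] P → P l → ∀ i → P (l + i * e)
  ⇝-iterate {P} {e} {l} pp p zero    = subst P (sym (+-identityʳ l)) p
  ⇝-iterate {P} {e} {l} pp p (suc i) =
    subst P (trans (+-assoc l (i * e) e) (cong (l +_) (+-comm (i * e) e))) (pp _ (⇝-iterate pp p i))

  Above : (ℕ → Set) → ℕ → Fin (#N G) → Set
  Above P lb B = ∃ λ e → lb ≤ e × P ⇝[ e ] Yields B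

  Rooted : (ℕ → Set) → Set
  Rooted P = ∃ λ r → P ⇝[ r ] Yields S

  above-extend : ∀ {P Q f lb B} → Q ⇝[ f ] P → Above P lb B → Above Q (f + lb) B
  above-extend {f = f} {B = B} qp (e , lb≤e , pB) = f + e , +-monoʳ-≤ f lb≤e , ⇝-trans {R = Yields B} qp pB

  above-weaken : ∀ {P lb lb′ B} → lb′ ≤ lb → Above P lb B → Above P lb′ B
  above-weaken lb′≤lb (e , lb≤e , pB) = e , ≤-trans lb′≤lb lb≤e , pB

  rooted-extend : ∀ {P Q f} → Q ⇝[ f ] P → Rooted P → Rooted Q
  rooted-extend {f = f} qp (r , pS) = f + r , ⇝-trans {R = Yields S} qp pS

  Pumpable : Set
  Pumpable = ∃₂ λ a e → 1 ≤ e × ∀ i → Yields S (a + i * e)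

  pump-at : ∀ {A l} → Above (Yields A) 1 A → Yields A l → Rooted (Yields A) → Pumpable
  pump-at {l = l} (e , 1≤e , AA) D (r , AS) =
    l + r , e , 1≤e , λ i → subst (Yields S) (+-swapʳ l (i * e) r) (AS _ (⇝-iterate AA D i))
    where
    +-swapʳ : ∀ a b c → a + b + c ≡ a + c + b
    +-swapʳ a b c = trans (+-assoc a b c) (trans (cong (a +_) (+-comm b c)) (sym (+-assoc a c b)))

  Covers : List (Fin (#N G)) → List (Fin (#N G)) → Set
  Covers bs rest = ∀ X → X ∈ bs ⊎ X ∈ rest

  -- Descend into a child whose yield still exceeds the bound.  For each B in bs,
  -- `above` is a context from the current position up to an occurrence of B
  -- entered through a rule of length ≥ 2, of width at least lb; once lb ≥ 1 a
  -- repeated nonterminal can be pumped.  In search-form the flag says that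
  -- width ≥ 1 is reached before descending: already, or via a sibling still to
  -- come.  Unit rules A → C are passed without a check, as they may close
  -- cycles of width 0.  Each nonterminal added to bs costs one factor M of the
  -- length bound, so a repetition is met before rest runs out.
  mutual
    search-node : ∀ {A w bs} → Derives G A w → ∀ rest → Covers bs rest →
                  All (Above (Yields A) 1) bs → Rooted (Yields A) →
                  M ^ length rest < length w → Pumpable
    search-node {A} {w} {bs} D rest covers above root bound with Any.any? (A ≟_) bs
    ... | yes A∈bs = pump-at (All.lookup above A∈bs) (subst (Derives G A) (ones-length w) D) root
    ... | no A∉bs  =
      search-rule D rest′ covers′ ((0 , z≤n , ⇝-refl) ∷ All.map (above-weaken z≤n) above) root bound′
      where
      rest′ = filter (λ X → ¬? (X ≟ A)) rest
      A∈rest : A ∈ rest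
      A∈rest with covers A
      ... | inj₁ A∈bs  = ⊥-elim (A∉bs A∈bs)
      ... | inj₂ A∈rest = A∈rest
      covers′ : Covers (A ∷ bs) rest′
      covers′ X with X ≟ A | covers X
      ... | yes X≡A | _ = inj₁ (here X≡A)
      ... | no _ | inj₁ X∈bs   = inj₁ (there X∈bs)
      ... | no X≢A | inj₂ X∈rest = inj₂ (∈-filter⁺ (λ X → ¬? (X ≟ A)) X∈rest X≢A)
      bound′ : M * M ^ length rest′ < length w
      bound′ = ≤-<-trans (^-monoʳ-≤ M (filter-notAll (λ X → ¬? (X ≟ A)) rest
                            (Any.map (λ A≡X X≢A → X≢A (sym A≡X)) A∈rest))) bound

    search-rule : ∀ {A w bs} → Derives G A w → ∀ rest → Covers bs rest →
                  All (Above (Yields A) 0) bs → Rooted (Yields A) →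
                  M * M ^ length rest < length w → Pumpable
    search-rule (rule {rhs = inj₂ zero ∷⁺ []} _ (term [])) rest _ _ _ bound =
      ⊥-elim (<⇒≱ bound (m^n>0 M (suc (length rest))))
    search-rule {A} (rule {rhs = inj₁ C ∷⁺ []} r∈ (nont {u = u} d [])) rest covers above root bound =
      search-rule d rest covers (All.map (above-extend unit) above) (rooted-extend unit root)
        (subst (M * M ^ length rest <_) (cong length (++-identityʳ u)) bound)
      where
      unit : Yields C ⇝[ 0 ] Yields A
      unit l d′ = subst (Yields A) (sym (+-identityʳ l))
                    (rule r∈ (subst (DerivesSeq G _) (++-identityʳ (ones l)) (nont d′ [])))
    search-rule {A} (rule {rhs = x ∷⁺ (y ∷ ys)} r∈ ds) rest covers above root bound =
      search-form ds rest covers (All.map (above-extend apply) above) (rooted-extend apply root)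
        (inj₂ (s≤s (s≤s z≤n))) (≤-<-trans (*-monoˡ-≤ (M ^ length rest) (rhs-length≤M r∈)) bound)
      where
      apply : YieldsSeq (x ∷ y ∷ ys) ⇝[ 0 ] Yields A
      apply l q = subst (Yields A) (sym (+-identityʳ l)) (rule r∈ q)

    search-form : ∀ {ss w bs lb} → DerivesSeq G ss w → ∀ rest → Covers bs rest →
                  All (Above (YieldsSeq ss) lb) bs → Rooted (YieldsSeq ss) →
                  1 ≤ lb ⊎ 2 ≤ length ss → length ss * M ^ length rest < length w → Pumpable
    search-form [] _ _ _ _ _ ()
    search-form (term {a = zero} ds) rest covers above root _ bound =
      search-form ds rest covers (All.map (above-extend terminal) above) (rooted-extend terminal root)
        (inj₁ (s≤s z≤n)) (+-<-cancel bound (m^n>0 M (length rest)))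
      where
      terminal : YieldsSeq _ ⇝[ 1 ] YieldsSeq (inj₂ zero ∷ _)
      terminal l q = subst (YieldsSeq _) (+-comm 1 l) (term q)
    search-form {inj₁ C ∷ ss} {lb = lb} (nont {u = u} {v} d ds) rest covers above root flag bound
      with M ^ length rest <? length u
    ... | yes big = search-node d rest covers (All.map (above-weaken (1≤v+lb flag) ∘ above-extend child) above)
                      (rooted-extend child root) big
      where
      child : Yields C ⇝[ length v ] YieldsSeq (inj₁ C ∷ ss)
      child l d′ = subst (DerivesSeq G _) (ones-++ l (length v))
                     (nont d′ (subst (DerivesSeq G ss) (ones-length v) ds))
      1≤v+lb : 1 ≤ lb ⊎ 2 ≤ length (inj₁ C ∷ ss) → 1 ≤ length v + lb
      1≤v+lb (inj₁ 1≤lb)        = ≤-trans 1≤lb (m≤n+m lb (length v))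
      1≤v+lb (inj₂ (s≤s 1≤ss)) = ≤-trans (derivesSeq-nonempty 1≤ss ds) (m≤m+n (length v) lb)
    ... | no small = search-form ds rest covers (All.map (above-extend sibling) above)
                       (rooted-extend sibling root)
                       (inj₁ (≤-trans (derives-nonempty d) (m≤m+n (length u) lb)))
                       (+-<-cancel (subst (_ <_) (length-++ u) bound) (≮⇒≥ small))
      where
      sibling : YieldsSeq ss ⇝[ length u ] YieldsSeq (inj₁ C ∷ ss)
      sibling l q = subst (DerivesSeq G _) (trans (ones-++ (length u) l) (cong ones (+-comm (length u) l)))
                      (nont (subst (Derives G C) (ones-length u) d) q)

  pumping : ∀ {w} → Derives G S w → M ^ #N G < length w → Pumpable
  pumping {w} D bound = search-node D (allFin _) (λ X → inj₂ (∈-allFin X)) [] (0 , ⇝-refl)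
    (subst (λ n → M ^ n < length w) (sym (length-tabulate {n = #N G} id)) bound)

powersOfTwo-noProgression : ∀ {a e} → 1 ≤ e → ¬ (∀ i → ∃ λ p → a + i * e ≡ 2 ^ p)
powersOfTwo-noProgression {a} {e} 1≤e powers with powers 0 | powers 1 | powers 2
... | p , a≡ | q , b≡ | r , c≡ = <-irrefl refl (begin-strict
  a + 2 * e         ≡⟨ cong (a +_) (*-distribʳ-+ e 1 1) ⟩
  a + (x + x)       ≡⟨ +-assoc a x x ⟨
  a + x + x         <⟨ +-monoʳ-< (a + x) (m<n+m x 0<a) ⟩
  (a + x) + (a + x) ≡⟨ cong₂ _+_ b≡ b≡ ⟩
  2 ^ q + 2 ^ q     ≡⟨ 2^-suc q ⟨
  2 ^ suc q         ≤⟨ ^-monoʳ-≤ 2 q<r ⟩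
  2 ^ r             ≡⟨ c≡ ⟨
  a + 2 * e         ∎)
  where
  open ≤-Reasoning
  x = 1 * e
  0<a : 0 < a
  0<a = subst (0 <_) (trans (sym a≡) (+-identityʳ a)) (m^n>0 2 p)
  q<r : q < r
  q<r = ≰⇒> λ r≤q → <⇒≱ (+-monoʳ-< a (m<n+m x 1≤e)) (begin
    a + 2 * e ≡⟨ c≡ ⟩
    2 ^ r     ≤⟨ ^-monoʳ-≤ 2 r≤q ⟩
    2 ^ q     ≡⟨ b≡ ⟨
    a + x     ∎)

holdsAtMin-isPowerOfTwoLength : ∀ (w : Word 1) →
  HoldsAtMin isPowerOfTwoLength w ⇔ ∃ λ p → length w ≡ 2 ^ p
holdsAtMin-isPowerOfTwoLength []       = mk⇔ (λ ()) (λ (p , 0≡2^p) → <⇒≢ (m^n>0 2 p) 0≡2^p)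
holdsAtMin-isPowerOfTwoLength (x ∷ xs) =
  eval-isPowerOfTwoLength {v = 1} (length xs) (lookup (x ∷ xs)) (λ _ → zero)

powerOfTwoLength-notCFL : ¬ IsCFL (HoldsAtMin {1} isPowerOfTwoLength)
powerOfTwoLength-notCFL (G , L⇔G) with pumping (Equivalence.to (L⇔G long) long∈L) long-exceeds-bound
  where
  open UnaryPumping G
  long = ones (2 ^ (M ^ #N G))
  long∈L = Equivalence.from (holdsAtMin-isPowerOfTwoLength long) (M ^ #N G , length-replicate _)
  long-exceeds-bound : M ^ #N G < length long
  long-exceeds-bound = subst (M ^ #N G <_) (sym (length-replicate _)) (n<2^n (M ^ #N G))
... | a , e , 1≤e , yields = powersOfTwo-noProgression 1≤e λ i →
  let p , len≡ = Equivalence.to (holdsAtMin-isPowerOfTwoLength (ones (a + i * e)))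
                   (Equivalence.from (L⇔G _) (yields i))
  in p , trans (sym (length-replicate (a + i * e))) len≡

lemma23 : ((k : ℕ) (L : Language k) → IsCFL L → IsQGrpFObit L)
          × (Σ ℕ λ k → Σ (Language k) λ L → IsQGrpFObit L × ¬ IsCFL L)
lemma23 = (λ _ → cfl⇒QGrpFObit)
        , (1 , HoldsAtMin isPowerOfTwoLength , holdsAtMin-QGrpFObit isPowerOfTwoLength , powerOfTwoLength-notCFL)
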